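{- Let $n\ge1$, $a_1,\dots,a_n\in\mathbb{N}$, and consider the system $F_0=F_1=\dots=F_n=0$ over $\mathbb{Q}(y)[x_1,\dots,x_n]$ with $F_0=y+\sum_{i=1}^n a_ix_i$ and $F_i=x_i^2-x_i$ ($1\le i\le n$). Then this system has an IPS-LIN$_{\mathbb{Q}(y)}$ certificate $H_0,\dots,H_n$ such that each $H_i$ is computed by a constant-free algebraic circuit over $\mathbb{Q}(y)$ of size polynomial in $a_1+\dots+a_n$.
   Context: $\mathbb{Q}(y)$ is the field of rational functions in the indeterminate $y$ over $\mathbb{Q}$. An IPS-LIN$_{\mathbb{Q}(y)}$ certificate of a system $F_0=\dots=F_m=0$ with $F_i\in\mathbb{Q}(y)[x_1,\dots,x_n]$ is a tuple $(H_0,\dots,H_m)$ of elements of $\mathbb{Q}(y)[x_1,\dots,x_n]$ with $\sum_iF_iH_i=1$ as a formal identity. An algebraic circuit is a finite DAG with leaves labelled by variables or constants and fan-in-two $+,\times$ gates; size = number of nodes. A constant-free circuit over $\mathbb{Q}(y)$ has constant leaves only among $0,1,-1,y$, and may contain division gates $u\div v$ where the subcircuit at $v$ contains no $x$-variables and computes a nonzero element of $\mathbb{Q}(y)$. -}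

module Defs where

open import Data.Nat as ℕ using (ℕ; zero; suc)
import Data.Nat.Properties as ℕP
open import Data.Integer using (+_)
open import Data.Rational using (ℚ; 0ℚ; 1ℚ; _/_) renaming (_+_ to _+ℚ_; _*_ to _*ℚ_; -_ to -ℚ_)
open import Data.Fin using (Fin; zero; suc)
open import Data.Vec using (Vec; []; _∷_; replicate; zipWith)
open import Data.Vec.Properties using (≡-dec)
open import Data.List using (List; []; _∷_; _++_; map; concatMap; foldr)
open import Data.List.Base using (allFin)
open import Data.Product using (_×_; _,_; proj₁; proj₂)
open import Data.Bool using (Bool; true; false; _∧_)
open import Data.Unit using (⊤)
open import Relation.Nullary using (¬_; yes; no)
open import Relation.Binary.PropositionalEquality using (_≡_)

-- Polynomials in Q[y, x_1, ..., x_n]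
-- A monomial is an exponent vector of length (suc n); index zero is the
-- exponent of y, index (suc i) the exponent of x_{i+1}.
-- A polynomial is a finite list of (coefficient, monomial) terms; two
-- polynomials are equal iff every monomial has the same total coefficient.

Mono : ℕ → Set
Mono n = Vec ℕ (suc n)

Poly : ℕ → Set
Poly n = List (ℚ × Mono n)

coeff : ∀ {n} → Poly n → Mono n → ℚ
coeff [] m = 0ℚ
coeff ((c , e) ∷ p) m with ≡-dec ℕP._≟_ e m
... | yes _ = c +ℚ coeff p m
... | no  _ = coeff p m

_≈P_ : ∀ {n} → Poly n → Poly n → Set
p ≈P q = ∀ m → coeff p m ≡ coeff q m

padd : ∀ {n} → Poly n → Poly n → Poly n
padd p q = p ++ q

pneg : ∀ {n} → Poly n → Poly n
pneg = map (λ { (c , e) → (-ℚ c , e) })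

pmul : ∀ {n} → Poly n → Poly n → Poly n
pmul p q = concatMap (λ { (c , e) → map (λ { (d , f) → (c *ℚ d , zipWith ℕ._+_ e f) }) q }) p

pconst : ∀ {n} → ℚ → Poly n
pconst c = (c , replicate _ 0) ∷ []

unitMono : ∀ {m} → Fin m → Vec ℕ m
unitMono {suc m} zero = 1 ∷ replicate m 0
unitMono (suc j) = 0 ∷ unitMono j

pY : ∀ {n} → Poly n
pY = (1ℚ , unitMono zero) ∷ []

pX : ∀ {n} → Fin n → Poly n
pX i = (1ℚ , unitMono (suc i)) ∷ []

-- Elements of Q(y)[x] computed by circuits are represented as fractions
-- num / den with num ∈ Q[y,x] and den ∈ Q[y] nonzero.

RF : ℕ → Set
RF n = Poly n × Poly n

rfAdd : ∀ {n} → RF n → RF n → RF n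
rfAdd (a , b) (c , d) = (padd (pmul a d) (pmul c b) , pmul b d)

rfMul : ∀ {n} → RF n → RF n → RF n
rfMul (a , b) (c , d) = (pmul a c , pmul b d)

rfDiv : ∀ {n} → RF n → RF n → RF n
rfDiv (a , b) (c , d) = (pmul a d , pmul b c)

rfPoly : ∀ {n} → Poly n → RF n
rfPoly p = (p , pconst 1ℚ)

-- Constant-free algebraic circuits over Q(y) (with division gates),
-- as DAGs given in topological order (straight-line programs).
-- A program SLP n k has k nodes; node zero is the most recently added one.

data Gate (n k : ℕ) : Set where
  var  : Fin n → Gate n k
  c0 c1 cm1 cy : Gate n k
  add mul div : Fin k → Fin k → Gate n k

data SLP (n : ℕ) : ℕ → Set where
  []  : SLP n 0
  _▷_ : ∀ {k} → SLP n k → Gate n k → SLP n (suc k)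

mutual
  val : ∀ {n k} → SLP n k → Fin k → RF n
  val (c ▷ g) zero    = gateVal c g
  val (c ▷ g) (suc j) = val c j

  gateVal : ∀ {n k} → SLP n k → Gate n k → RF n
  gateVal c (var i)   = rfPoly (pX i)
  gateVal c c0        = rfPoly (pconst 0ℚ)
  gateVal c c1        = rfPoly (pconst 1ℚ)
  gateVal c cm1       = rfPoly (pconst (-ℚ 1ℚ))
  gateVal c cy        = rfPoly pY
  gateVal c (add u v) = rfAdd (val c u) (val c v)
  gateVal c (mul u v) = rfMul (val c u) (val c v)
  gateVal c (div u v) = rfDiv (val c u) (val c v)

mutual
  noX : ∀ {n k} → SLP n k → Fin k → Bool
  noX (c ▷ g) zero    = gateNoX c g
  noX (c ▷ g) (suc j) = noX c j

  gateNoX : ∀ {n k} → SLP n k → Gate n k → Bool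
  gateNoX c (var i)   = false
  gateNoX c c0        = true
  gateNoX c c1        = true
  gateNoX c cm1       = true
  gateNoX c cy        = true
  gateNoX c (add u v) = noX c u ∧ noX c v
  gateNoX c (mul u v) = noX c u ∧ noX c v
  gateNoX c (div u v) = noX c u ∧ noX c v

-- well-formedness: every division gate u ÷ v has an x-free divisor
-- subcircuit computing a nonzero element of Q(y)
GateOK : ∀ {n k} → SLP n k → Gate n k → Set
GateOK c (div u v) = (noX c v ≡ true) × ¬ (proj₁ (val c v) ≈P [])
GateOK c _ = ⊤

WF : ∀ {n k} → SLP n k → Set
WF [] = ⊤
WF (c ▷ g) = WF c × GateOK c g

record Circuit (n : ℕ) : Set where
  constructor circuit
  field
    nodes : ℕ
    prog  : SLP n (suc nodes)
    wf    : WF prog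

size : ∀ {n} → Circuit n → ℕ
size C = suc (Circuit.nodes C)

output : ∀ {n} → Circuit n → RF n
output C = val (Circuit.prog C) zero

ℕtoℚ : ℕ → ℚ
ℕtoℚ a = + a / 1

lookupV : ∀ {A : Set} {n} → Vec A n → Fin n → A
lookupV (x ∷ xs) zero = x
lookupV (x ∷ xs) (suc i) = lookupV xs i

sumV : ∀ {n} → Vec ℕ n → ℕ
sumV [] = 0
sumV (x ∷ xs) = x ℕ.+ sumV xs

sysF : ∀ {n} → Vec ℕ n → Fin (suc n) → Poly n
sysF a zero    = padd pY (concatMap (λ i → (ℕtoℚ (lookupV a i) , unitMono (suc i)) ∷ []) (allFin _))
sysF a (suc i) = padd (pmul (pX i) (pX i)) (pneg (pX i))

-- the formal identity Σ_i F_i H_i = 1 in Q(y)[x]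
-- (a fraction num/den equals 1 iff num = den as polynomials)
IsIPSLINCert : ∀ {n} → Vec ℕ n → (Fin (suc n) → RF n) → Set
IsIPSLINCert {n} a H =
  let S = foldr (λ i acc → rfAdd (rfMul (rfPoly (sysF a i)) (H i)) acc)
                (rfPoly (pconst 0ℚ)) (allFin (suc n))
  in proj₁ S ≈P proj₂ S

-- On the Boolean cube, y + Σ aᵢxᵢ takes only the values y + k with 0 ≤ k ≤ B = Σ aᵢ,
-- so modulo the ideal of the xᵢ² − xᵢ it divides D = Π_{k ≤ B} (y + k).  The cofactor
-- is built one variable at a time: modulo x² − x a polynomial in x equals
-- (1 − x)·(its value at x = 0) + x·(its value at x = 1), so the cofactors of
-- y + k + αx + S for all shifts k ≤ B come from those of y + k + S with O(B) gates
-- per unit of α, and what is lost is an explicit multiple of x² − x.  This yields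
--   (y + Σ aᵢxᵢ) · G = D + Σ (xᵢ² − xᵢ) · Qᵢ
-- with G and the Qᵢ computed by circuits of size O(B²), and H₀ = G / D, Hᵢ = −Qᵢ / D
-- is the certificate; D is x-free and nonzero, so the one division gate is legal.

module Submission where

open import Defs
open import Data.Nat as ℕ using (ℕ; zero; suc; _≤_; _<_; _+_; _*_; _^_; _∸_; _⊓_; z≤n; s≤s)
import Data.Nat.Properties as ℕP
open import Data.Nat.Solver renaming (module +-*-Solver to ℕ-Solver)
open import Data.Nat.Coprimality using (1-coprimeTo) renaming (sym to coprime-sym)
import Data.Integer.Properties as ℤP
open import Data.Rational using (ℚ; 0ℚ; 1ℚ; Positive)
  renaming (_+_ to _+ℚ_; _*_ to _*ℚ_; -_ to -ℚ_; _<_ to _<ℚ_)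
import Data.Rational.Properties as ℚP
open import Data.Rational.Solver renaming (module +-*-Solver to ℚ-Solver)
open import Data.Fin using (Fin; zero; suc)
open import Data.Vec using (Vec; []; _∷_; replicate; zipWith)
open import Data.Vec.Properties using (zipWith-comm; zipWith-assoc; zipWith-identityˡ; ≡-dec)
open import Data.List using (List; []; _∷_; _++_; map; concatMap; length; tabulate; foldr)
open import Data.List.Properties using (++-assoc)
open import Data.Product using (Σ; _×_; _,_; proj₁; proj₂)
open import Data.Bool using (true; _∧_)
open import Data.Unit using (tt)
open import Data.Empty using (⊥-elim)
open import Data.Maybe using (Maybe; just; nothing)
open import Function using (_∘_; id)
open import Relation.Nullary using (¬_; yes; no)
open import Relation.Binary.PropositionalEquality
  using (_≡_; refl; sym; trans; cong; cong₂; subst; module ≡-Reasoning)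
open import Algebra.Bundles using (CommutativeRing)
open import Algebra.Solver.Ring.AlmostCommutativeRing using (fromCommutativeRing; _-Raw-AlmostCommutative⟶_)
import Algebra.Solver.Ring

-- The ring of polynomials

_⊕_ : ∀ {k} → Vec ℕ k → Vec ℕ k → Vec ℕ k
_⊕_ = zipWith _+_

-- A polynomial p acts on g : Mono n → ℚ as the finite sum Σ c · g e over its
-- terms.  Equality of all these sums (_≋_) makes the ring laws easy, and
-- implies coefficientwise equality (≋⇒≈P) by taking g an indicator.
lin : ∀ {n} → (Mono n → ℚ) → Poly n → ℚ
lin g [] = 0ℚ
lin g ((c , e) ∷ p) = c *ℚ g e +ℚ lin g p

module _ {n : ℕ} where

  lin-++ : ∀ g (p q : Poly n) → lin g (p ++ q) ≡ lin g p +ℚ lin g q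
  lin-++ g [] q = sym (ℚP.+-identityˡ _)
  lin-++ g ((c , e) ∷ p) q rewrite lin-++ g p q = sym (ℚP.+-assoc (c *ℚ g e) (lin g p) (lin g q))

  lin-pneg : ∀ g (p : Poly n) → lin g (pneg p) ≡ -ℚ lin g p
  lin-pneg g [] = refl
  lin-pneg g ((c , e) ∷ p) rewrite lin-pneg g p =
    solve 3 (λ c x l → (:- c) :* x :+ (:- l) := :- (c :* x :+ l)) refl c (g e) (lin g p)
    where open ℚ-Solver

  lin-cong : ∀ {g h : Mono n → ℚ} → (∀ e → g e ≡ h e) → ∀ p → lin g p ≡ lin h p
  lin-cong g≗h [] = refl
  lin-cong g≗h ((c , e) ∷ p) = cong₂ (λ a b → c *ℚ a +ℚ b) (g≗h e) (lin-cong g≗h p)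

  lin-+ : ∀ (g h : Mono n → ℚ) p → lin (λ e → g e +ℚ h e) p ≡ lin g p +ℚ lin h p
  lin-+ g h [] = sym (ℚP.+-identityˡ _)
  lin-+ g h ((c , e) ∷ p) rewrite lin-+ g h p =
    solve 5 (λ c x y a b → c :* (x :+ y) :+ (a :+ b) := (c :* x :+ a) :+ (c :* y :+ b))
      refl c (g e) (h e) (lin g p) (lin h p)
    where open ℚ-Solver

  lin-* : ∀ d (g : Mono n → ℚ) p → lin (λ e → d *ℚ g e) p ≡ d *ℚ lin g p
  lin-* d g [] = sym (ℚP.*-zeroʳ d)
  lin-* d g ((c , e) ∷ p) rewrite lin-* d g p =
    solve 4 (λ d c x a → c :* (d :* x) :+ d :* a := d :* (c :* x :+ a)) refl d c (g e) (lin g p)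
    where open ℚ-Solver

  lin-0 : ∀ (p : Poly n) → lin (λ _ → 0ℚ) p ≡ 0ℚ
  lin-0 [] = refl
  lin-0 ((c , e) ∷ p) rewrite lin-0 p | ℚP.*-zeroʳ c = refl

  private
    shiftTerm : ℚ × Mono n → ℚ × Mono n → ℚ × Mono n
    shiftTerm (c , e) (d , f) = (c *ℚ d , e ⊕ f)

    lin-shift : ∀ g c e (q : Poly n) → lin g (map (shiftTerm (c , e)) q) ≡ c *ℚ lin (λ f → g (e ⊕ f)) q
    lin-shift g c e [] = sym (ℚP.*-zeroʳ c)
    lin-shift g c e ((d , f) ∷ q) rewrite lin-shift g c e q =
      solve 4 (λ c d x a → c :* d :* x :+ c :* a := c :* (d :* x :+ a)) refl c d (g (e ⊕ f)) _
      where open ℚ-Solver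

  lin-pmul : ∀ g (p q : Poly n) → lin g (pmul p q) ≡ lin (λ e → lin (λ f → g (e ⊕ f)) q) p
  lin-pmul g [] q = refl
  lin-pmul g ((c , e) ∷ p) q =
    trans (lin-++ g (map (shiftTerm (c , e)) q) (pmul p q)) (cong₂ _+ℚ_ (lin-shift g c e q) (lin-pmul g p q))

  lin-swap : ∀ (h : Mono n → Mono n → ℚ) (p q : Poly n) →
             lin (λ e → lin (h e) q) p ≡ lin (λ f → lin (λ e → h e f) p) q
  lin-swap h [] q = sym (lin-0 q)
  lin-swap h ((c , e) ∷ p) q = begin
    c *ℚ lin (h e) q +ℚ lin (λ e → lin (h e) q) p
      ≡⟨ cong₂ _+ℚ_ (sym (lin-* c (h e) q)) (lin-swap h p q) ⟩
    lin (λ f → c *ℚ h e f) q +ℚ lin (λ f → lin (λ e → h e f) p) q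
      ≡⟨ sym (lin-+ _ _ q) ⟩
    lin (λ f → c *ℚ h e f +ℚ lin (λ e → h e f) p) q ∎
    where open ≡-Reasoning

infix 4 _≋_
record _≋_ {n} (p q : Poly n) : Set where
  constructor mk≋
  field lin-≡ : ∀ g → lin g p ≡ lin g q
open _≋_ public

module _ {n : ℕ} where

  1P : Poly n
  1P = pconst 1ℚ

  ≋-refl : ∀ {p : Poly n} → p ≋ p
  ≋-refl = mk≋ (λ _ → refl)

  ≋-sym : ∀ {p q : Poly n} → p ≋ q → q ≋ p
  ≋-sym (mk≋ e) = mk≋ (λ g → sym (e g))

  ≋-trans : ∀ {p q r : Poly n} → p ≋ q → q ≋ r → p ≋ r
  ≋-trans (mk≋ e) (mk≋ f) = mk≋ (λ g → trans (e g) (f g))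

  padd-cong : ∀ {p p′ q q′ : Poly n} → p ≋ p′ → q ≋ q′ → padd p q ≋ padd p′ q′
  padd-cong {p} {p′} {q} {q′} (mk≋ e) (mk≋ f) =
    mk≋ (λ g → trans (lin-++ g p q) (trans (cong₂ _+ℚ_ (e g) (f g)) (sym (lin-++ g p′ q′))))

  padd-congˡ : ∀ r {q q′ : Poly n} → q ≋ q′ → padd r q ≋ padd r q′
  padd-congˡ r = padd-cong (≋-refl {r})

  padd-congʳ : ∀ r {p p′ : Poly n} → p ≋ p′ → padd p r ≋ padd p′ r
  padd-congʳ r p≋p′ = padd-cong p≋p′ (≋-refl {r})

  padd-assoc : ∀ (p q r : Poly n) → padd (padd p q) r ≋ padd p (padd q r)
  padd-assoc p q r = mk≋ (λ g → cong (lin g) (++-assoc p q r))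

  padd-comm : ∀ (p q : Poly n) → padd p q ≋ padd q p
  padd-comm p q = mk≋ (λ g → trans (lin-++ g p q) (trans (ℚP.+-comm (lin g p) (lin g q)) (sym (lin-++ g q p))))

  padd-identityʳ : ∀ (p : Poly n) → padd p [] ≋ p
  padd-identityʳ p = mk≋ (λ g → trans (lin-++ g p []) (ℚP.+-identityʳ _))

  pneg-cong : ∀ {p q : Poly n} → p ≋ q → pneg p ≋ pneg q
  pneg-cong {p} {q} (mk≋ e) = mk≋ (λ g → trans (lin-pneg g p) (trans (cong -ℚ_ (e g)) (sym (lin-pneg g q))))

  pneg-inverseʳ : ∀ (p : Poly n) → padd p (pneg p) ≋ []
  pneg-inverseʳ p =
    mk≋ (λ g → trans (lin-++ g p (pneg p)) (trans (cong (lin g p +ℚ_) (lin-pneg g p)) (ℚP.+-inverseʳ (lin g p))))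

  pmul-cong : ∀ {p p′ q q′ : Poly n} → p ≋ p′ → q ≋ q′ → pmul p q ≋ pmul p′ q′
  pmul-cong {p} {p′} {q} {q′} (mk≋ e) (mk≋ f) = mk≋ λ g → begin
    lin g (pmul p q)                          ≡⟨ lin-pmul g p q ⟩
    lin (λ e → lin (λ f → g (e ⊕ f)) q) p     ≡⟨ e _ ⟩
    lin (λ e → lin (λ f → g (e ⊕ f)) q) p′    ≡⟨ lin-cong (λ x → f (λ f → g (x ⊕ f))) p′ ⟩
    lin (λ e → lin (λ f → g (e ⊕ f)) q′) p′   ≡⟨ lin-pmul g p′ q′ ⟨
    lin g (pmul p′ q′)                        ∎
    where open ≡-Reasoning

  pmul-congˡ : ∀ r {q q′ : Poly n} → q ≋ q′ → pmul r q ≋ pmul r q′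
  pmul-congˡ r = pmul-cong (≋-refl {r})

  pmul-congʳ : ∀ r {p p′ : Poly n} → p ≋ p′ → pmul p r ≋ pmul p′ r
  pmul-congʳ r p≋p′ = pmul-cong p≋p′ (≋-refl {r})

  pmul-assoc : ∀ (p q r : Poly n) → pmul (pmul p q) r ≋ pmul p (pmul q r)
  pmul-assoc p q r = mk≋ λ g → begin
    lin g (pmul (pmul p q) r)
      ≡⟨ lin-pmul g (pmul p q) r ⟩
    lin (λ e → lin (λ f → g (e ⊕ f)) r) (pmul p q)
      ≡⟨ lin-pmul _ p q ⟩
    lin (λ e → lin (λ e′ → lin (λ f → g ((e ⊕ e′) ⊕ f)) r) q) p
      ≡⟨ lin-cong (λ e → lin-cong (λ e′ → lin-cong (λ f → cong g (zipWith-assoc ℕP.+-assoc e e′ f)) r) q) p ⟩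
    lin (λ e → lin (λ e′ → lin (λ f → g (e ⊕ (e′ ⊕ f))) r) q) p
      ≡⟨ lin-cong (λ e → lin-pmul (λ x → g (e ⊕ x)) q r) p ⟨
    lin (λ e → lin (λ f → g (e ⊕ f)) (pmul q r)) p
      ≡⟨ lin-pmul g p (pmul q r) ⟨
    lin g (pmul p (pmul q r)) ∎
    where open ≡-Reasoning

  pmul-comm : ∀ (p q : Poly n) → pmul p q ≋ pmul q p
  pmul-comm p q = mk≋ λ g → begin
    lin g (pmul p q)                        ≡⟨ lin-pmul g p q ⟩
    lin (λ e → lin (λ f → g (e ⊕ f)) q) p   ≡⟨ lin-swap (λ e f → g (e ⊕ f)) p q ⟩
    lin (λ f → lin (λ e → g (e ⊕ f)) p) q
      ≡⟨ lin-cong (λ f → lin-cong (λ e → cong g (zipWith-comm ℕP.+-comm e f)) p) q ⟩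
    lin (λ f → lin (λ e → g (f ⊕ e)) p) q   ≡⟨ lin-pmul g q p ⟨
    lin g (pmul q p)                        ∎
    where open ≡-Reasoning

  pmul-identityˡ : ∀ (p : Poly n) → pmul 1P p ≋ p
  pmul-identityˡ p = mk≋ λ g → begin
    lin g (pmul 1P p)                                   ≡⟨ lin-pmul g 1P p ⟩
    1ℚ *ℚ lin (λ f → g (replicate _ 0 ⊕ f)) p +ℚ 0ℚ     ≡⟨ ℚP.+-identityʳ _ ⟩
    1ℚ *ℚ lin (λ f → g (replicate _ 0 ⊕ f)) p           ≡⟨ ℚP.*-identityˡ _ ⟩
    lin (λ f → g (replicate _ 0 ⊕ f)) p
      ≡⟨ lin-cong (λ f → cong g (zipWith-identityˡ ℕP.+-identityˡ f)) p ⟩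
    lin g p                                             ∎
    where open ≡-Reasoning

  pmul-identityʳ : ∀ (p : Poly n) → pmul p 1P ≋ p
  pmul-identityʳ p = ≋-trans (pmul-comm p 1P) (pmul-identityˡ p)

  pmul-zeroʳ : ∀ (p : Poly n) → pmul p [] ≋ []
  pmul-zeroʳ p = mk≋ (λ g → trans (lin-pmul g p []) (lin-0 p))

  pmul-distribˡ : ∀ (p q r : Poly n) → pmul p (padd q r) ≋ padd (pmul p q) (pmul p r)
  pmul-distribˡ p q r = mk≋ λ g → begin
    lin g (pmul p (q ++ r))
      ≡⟨ lin-pmul g p (q ++ r) ⟩
    lin (λ e → lin (λ f → g (e ⊕ f)) (q ++ r)) p
      ≡⟨ lin-cong (λ e → lin-++ _ q r) p ⟩
    lin (λ e → lin (λ f → g (e ⊕ f)) q +ℚ lin (λ f → g (e ⊕ f)) r) p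
      ≡⟨ lin-+ _ _ p ⟩
    lin (λ e → lin (λ f → g (e ⊕ f)) q) p +ℚ lin (λ e → lin (λ f → g (e ⊕ f)) r) p
      ≡⟨ cong₂ _+ℚ_ (lin-pmul g p q) (lin-pmul g p r) ⟨
    lin g (pmul p q) +ℚ lin g (pmul p r)
      ≡⟨ lin-++ g (pmul p q) (pmul p r) ⟨
    lin g (pmul p q ++ pmul p r) ∎
    where open ≡-Reasoning

  polyRing : CommutativeRing _ _
  polyRing = record
    { Carrier = Poly n ; _≈_ = _≋_ ; _+_ = padd ; _*_ = pmul ; -_ = pneg ; 0# = [] ; 1# = 1P
    ; isCommutativeRing = record
      { isRing = record
        { +-isAbelianGroup = record
          { isGroup = record
            { isMonoid = record
              { isSemigroup = record
                { isMagma = record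
                  { isEquivalence = record { refl = ≋-refl ; sym = ≋-sym ; trans = ≋-trans }
                  ; ∙-cong = padd-cong }
                ; assoc = padd-assoc }
              ; identity = (λ _ → ≋-refl) , padd-identityʳ }
            ; inverse = (λ p → ≋-trans (padd-comm (pneg p) p) (pneg-inverseʳ p)) , pneg-inverseʳ
            ; ⁻¹-cong = pneg-cong }
          ; comm = padd-comm }
        ; *-cong = pmul-cong
        ; *-assoc = pmul-assoc
        ; *-identity = pmul-identityˡ , pmul-identityʳ
        ; distrib = pmul-distribˡ
                  , (λ p q r → ≋-trans (pmul-comm (padd q r) p)
                      (≋-trans (pmul-distribˡ p q r) (padd-cong (pmul-comm p q) (pmul-comm p r)))) }
      ; *-comm = pmul-comm } }

pconst-+ : ∀ {n} a b → pconst {n} (a +ℚ b) ≋ padd (pconst a) (pconst b)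
pconst-+ a b = mk≋ (λ g → solve 3 (λ a b x → (a :+ b) :* x :+ con 0ℚ := a :* x :+ (b :* x :+ con 0ℚ))
                                  refl a b (g (replicate _ 0)))
  where open ℚ-Solver

pconst-0 : ∀ {n} → pconst {n} 0ℚ ≋ []
pconst-0 = mk≋ (λ g → trans (ℚP.+-identityʳ (0ℚ *ℚ g (replicate _ 0))) (ℚP.*-zeroˡ (g (replicate _ 0))))

pconst-*-monomial : ∀ {n} c (e : Mono n) → pmul (pconst c) ((1ℚ , e) ∷ []) ≋ (c , e) ∷ []
pconst-*-monomial c e =
  mk≋ (λ g → cong (_+ℚ 0ℚ) (cong₂ _*ℚ_ (ℚP.*-identityʳ c) (cong g (zipWith-identityˡ ℕP.+-identityˡ e))))

coeffSum : ∀ {n} → Poly n → ℚ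
coeffSum = lin (λ _ → 1ℚ)

coeffSum-pconst : ∀ {n} c → coeffSum (pconst {n} c) ≡ c
coeffSum-pconst c = trans (ℚP.+-identityʳ (c *ℚ 1ℚ)) (ℚP.*-identityʳ c)

coeffSum-pmul : ∀ {n} (p q : Poly n) → coeffSum (pmul p q) ≡ coeffSum p *ℚ coeffSum q
coeffSum-pmul p q = begin
  coeffSum (pmul p q)              ≡⟨ lin-pmul (λ _ → 1ℚ) p q ⟩
  lin (λ _ → coeffSum q) p         ≡⟨ lin-cong (λ _ → sym (ℚP.*-identityʳ (coeffSum q))) p ⟩
  lin (λ _ → coeffSum q *ℚ 1ℚ) p   ≡⟨ lin-* (coeffSum q) (λ _ → 1ℚ) p ⟩
  coeffSum q *ℚ coeffSum p         ≡⟨ ℚP.*-comm (coeffSum q) (coeffSum p) ⟩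
  coeffSum p *ℚ coeffSum q         ∎
  where open ≡-Reasoning

-- In PolySolver, `con c` denotes the constant polynomial `pconst c`.
module PolySolver (n : ℕ) where
  private
    ring = fromCommutativeRing (polyRing {n})
    open CommutativeRing ℚP.+-*-commutativeRing using (rawRing)

    pconst-hom : rawRing -Raw-AlmostCommutative⟶ ring
    pconst-hom = record
      { ⟦_⟧ = pconst
      ; +-homo = pconst-+
      ; *-homo = λ a b → mk≋ (λ g → cong (λ v → a *ℚ b *ℚ g v +ℚ 0ℚ)
                                        (sym (zipWith-identityˡ ℕP.+-identityˡ (replicate _ 0))))
      ; -‿homo = λ _ → ≋-refl
      ; 0-homo = pconst-0
      ; 1-homo = ≋-refl }

    pconst-≋? : ∀ a b → Maybe (pconst {n} a ≋ pconst b)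
    pconst-≋? a b with a ℚP.≟ b
    ... | yes refl = just ≋-refl
    ... | no _     = nothing

  open Algebra.Solver.Ring rawRing ring pconst-hom pconst-≋? public

module _ {n : ℕ} where

  private
    indicator : Mono n → Mono n → ℚ
    indicator m e with ≡-dec ℕP._≟_ e m
    ... | yes _ = 1ℚ
    ... | no _  = 0ℚ

    coeff≡lin : ∀ (p : Poly n) m → coeff p m ≡ lin (indicator m) p
    coeff≡lin [] m = refl
    coeff≡lin ((c , e) ∷ p) m with ≡-dec ℕP._≟_ e m
    ... | yes _ = cong₂ _+ℚ_ (sym (ℚP.*-identityʳ c)) (coeff≡lin p m)
    ... | no _  = trans (coeff≡lin p m) (sym (trans (cong (_+ℚ lin (indicator m) p) (ℚP.*-zeroʳ c)) (ℚP.+-identityˡ _)))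

  ≋⇒≈P : ∀ {p q : Poly n} → p ≋ q → p ≈P q
  ≋⇒≈P {p} {q} (mk≋ e) m = trans (coeff≡lin p m) (trans (e (indicator m)) (sym (coeff≡lin q m)))

  private
    without : Mono n → Poly n → Poly n
    without e [] = []
    without e ((c , f) ∷ r) with ≡-dec ℕP._≟_ f e
    ... | yes _ = without e r
    ... | no _  = (c , f) ∷ without e r

    lin-split : ∀ g e (r : Poly n) → lin g r ≡ coeff r e *ℚ g e +ℚ lin g (without e r)
    lin-split g e [] = sym (cong (_+ℚ 0ℚ) (ℚP.*-zeroˡ (g e)))
    lin-split g e ((c , f) ∷ r) with ≡-dec ℕP._≟_ f e
    ... | yes refl rewrite lin-split g f r =
      solve 4 (λ c x k l → c :* x :+ (k :* x :+ l) := (c :+ k) :* x :+ l) refl c (g f) (coeff r f) (lin g (without f r))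
      where open ℚ-Solver
    ... | no _ rewrite lin-split g e r =
      solve 5 (λ c x k y l → c :* x :+ (k :* y :+ l) := k :* y :+ (c :* x :+ l)) refl c (g f) (coeff r e) (g e) (lin g (without e r))
      where open ℚ-Solver

    coeff-without : ∀ e m (r : Poly n) → ¬ m ≡ e → coeff (without e r) m ≡ coeff r m
    coeff-without e m [] m≢e = refl
    coeff-without e m ((c , f) ∷ r) m≢e with ≡-dec ℕP._≟_ f e
    ... | yes refl with ≡-dec ℕP._≟_ f m
    ...   | yes refl = ⊥-elim (m≢e refl)
    ...   | no _     = coeff-without e m r m≢e
    coeff-without e m ((c , f) ∷ r) m≢e | no _ with ≡-dec ℕP._≟_ f m
    ...   | yes _ = cong (c +ℚ_) (coeff-without e m r m≢e)
    ...   | no _  = coeff-without e m r m≢e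

    coeff-without-self : ∀ e (r : Poly n) → coeff (without e r) e ≡ 0ℚ
    coeff-without-self e [] = refl
    coeff-without-self e ((c , f) ∷ r) with ≡-dec ℕP._≟_ f e
    ... | yes _ = coeff-without-self e r
    ... | no f≢e with ≡-dec ℕP._≟_ f e
    ...   | yes f≡e = ⊥-elim (f≢e f≡e)
    ...   | no _    = coeff-without-self e r

    length-without : ∀ e (r : Poly n) → length (without e r) ≤ length r
    length-without e [] = z≤n
    length-without e ((c , f) ∷ r) with ≡-dec ℕP._≟_ f e
    ... | yes _ = ℕP.m≤n⇒m≤1+n (length-without e r)
    ... | no _  = s≤s (length-without e r)

    -- by induction on an upper bound for the length, since `without e r`
    -- is not a structural subterm of r
    lin-≈P[]-bounded : ∀ k g (r : Poly n) → length r ≤ k → r ≈P [] → lin g r ≡ 0ℚ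
    lin-≈P[]-bounded k g [] _ _ = refl
    lin-≈P[]-bounded (suc k) g r@((_ , e) ∷ r₀) (s≤s len≤k) r≈0 = begin
      lin g r                                   ≡⟨ lin-split g e r ⟩
      coeff r e *ℚ g e +ℚ lin g (without e r)
        ≡⟨ cong₂ (λ a b → a *ℚ g e +ℚ b) (r≈0 e) (lin-≈P[]-bounded k g (without e r) len′ r′≈0) ⟩
      0ℚ *ℚ g e +ℚ 0ℚ                           ≡⟨ cong (_+ℚ 0ℚ) (ℚP.*-zeroˡ (g e)) ⟩
      0ℚ                                        ∎
      where
      open ≡-Reasoning
      len′ : length (without e r) ≤ k
      len′ with ≡-dec ℕP._≟_ e e
      ... | yes _ = ℕP.≤-trans (length-without e r₀) len≤k
      ... | no e≢e = ⊥-elim (e≢e refl)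
      r′≈0 : without e r ≈P []
      r′≈0 m with ≡-dec ℕP._≟_ m e
      ... | yes refl = coeff-without-self m r
      ... | no m≢e   = trans (coeff-without e m r m≢e) (r≈0 m)

  lin-≈P[] : ∀ g (r : Poly n) → r ≈P [] → lin g r ≡ 0ℚ
  lin-≈P[] g r = lin-≈P[]-bounded (length r) g r ℕP.≤-refl

-- The certificate identity

ℕtoℚ-suc : ∀ k → ℕtoℚ (suc k) ≡ 1ℚ +ℚ ℕtoℚ k
ℕtoℚ-suc k rewrite ℚP.normalize-coprime (coprime-sym (1-coprimeTo k)) | ℕP.*-identityʳ k | ℤP.+◃n≡+n k = refl

module _ {n : ℕ} where
  open CommutativeRing (polyRing {n}) using (semiring)
    renaming (_+_ to _+ₚ_; _*_ to _*ₚ_)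
  open import Algebra.Properties.Semiring.Mult semiring using (×-homo-+) renaming (_×_ to _×ₚ_)
  open import Algebra.Properties.Semiring.Sum semiring using (sum; sum-syntax; ∑-distrib-+; *-distribˡ-sum; sum-cong-≋)
  open import Relation.Binary.Reasoning.Setoid (CommutativeRing.setoid (polyRing {n}))
  open PolySolver n using (solve; _:+_; _:*_; :-_; _:=_; con)

  ×1≋pconst : ∀ k → k ×ₚ 1P ≋ pconst (ℕtoℚ k)
  ×1≋pconst zero = mk≋ (λ g → sym (trans (ℚP.+-identityʳ _) (ℚP.*-zeroˡ (g (replicate _ 0)))))
  ×1≋pconst (suc k) = begin
    1P +ₚ k ×ₚ 1P                ≈⟨ padd-congˡ 1P (×1≋pconst k) ⟩
    1P +ₚ pconst (ℕtoℚ k)        ≈⟨ pconst-+ 1ℚ (ℕtoℚ k) ⟨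
    pconst (1ℚ +ℚ ℕtoℚ k)        ≡⟨ cong pconst (ℕtoℚ-suc k) ⟨
    pconst (ℕtoℚ (suc k))        ∎

  −1ₚ : Poly n
  −1ₚ = pconst (-ℚ 1ℚ)

  boolAxiom : Poly n → Poly n
  boolAxiom x = x *ₚ x +ₚ pneg x

  y+_ : ℕ → Poly n
  y+ k = pY +ₚ k ×ₚ 1P

  y+-+ : ∀ k j → y+ (k + j) ≋ y+ k +ₚ j ×ₚ 1P
  y+-+ k j = begin
    pY +ₚ (k + j) ×ₚ 1P        ≈⟨ padd-congˡ pY (×-homo-+ 1P k j) ⟩
    pY +ₚ (k ×ₚ 1P +ₚ j ×ₚ 1P)   ≈⟨ padd-assoc pY (k ×ₚ 1P) (j ×ₚ 1P) ⟨
    y+ k +ₚ j ×ₚ 1P              ∎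

  ΠY : ℕ → Poly n
  ΠY zero    = 1P
  ΠY (suc j) = ΠY j *ₚ y+ j

  ΠY-without : ℕ → ℕ → Poly n
  ΠY-without k zero = 1P
  ΠY-without k (suc j) with j ℕ.≟ k
  ... | yes _ = ΠY-without k j
  ... | no _  = ΠY-without k j *ₚ y+ j

  ΠY-without-below : ∀ k j → j ≤ k → ΠY-without k j ≡ ΠY j
  ΠY-without-below k zero j≤k = refl
  ΠY-without-below k (suc j) j<k with j ℕ.≟ k
  ... | yes refl = ⊥-elim (ℕP.<-irrefl refl j<k)
  ... | no _     = cong (_*ₚ y+ j) (ΠY-without-below k j (ℕP.<⇒≤ j<k))

  y+*ΠY-without : ∀ k j → k < j → y+ k *ₚ ΠY-without k j ≋ ΠY j
  y+*ΠY-without k (suc j) k<1+j with j ℕ.≟ k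
  ... | yes refl = begin
    y+ j *ₚ ΠY-without j j   ≡⟨ cong (y+ j *ₚ_) (ΠY-without-below j j ℕP.≤-refl) ⟩
    y+ j *ₚ ΠY j             ≈⟨ pmul-comm (y+ j) (ΠY j) ⟩
    ΠY (suc j)               ∎
  ... | no j≢k = begin
    y+ k *ₚ (ΠY-without k j *ₚ y+ j)   ≈⟨ pmul-assoc (y+ k) (ΠY-without k j) (y+ j) ⟨
    (y+ k *ₚ ΠY-without k j) *ₚ y+ j
      ≈⟨ pmul-congʳ (y+ j) (y+*ΠY-without k j (ℕP.≤∧≢⇒< (ℕP.≤-pred k<1+j) (j≢k ∘ sym))) ⟩
    ΠY (suc j)                         ∎

  coeffSum-y+ : ∀ k → coeffSum (y+ k) ≡ ℕtoℚ (suc k)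
  coeffSum-y+ k =
    trans (lin-++ (λ _ → 1ℚ) pY (k ×ₚ 1P))
          (trans (cong₂ _+ℚ_ (coeffSum-pconst {n} 1ℚ) (trans (lin-≡ (×1≋pconst k) (λ _ → 1ℚ)) (coeffSum-pconst {n} (ℕtoℚ k))))
                 (sym (ℕtoℚ-suc k)))

  coeffSum-ΠY-positive : ∀ j → Positive (coeffSum (ΠY j))
  coeffSum-ΠY-positive zero    = subst Positive (sym (coeffSum-pconst {n} 1ℚ)) (ℚP.normalize-pos 1 1)
  coeffSum-ΠY-positive (suc j) = subst Positive (sym (coeffSum-pmul (ΠY j) (y+ j)))
    (ℚP.pos*pos⇒pos (coeffSum (ΠY j)) {{coeffSum-ΠY-positive j}}
                    (coeffSum (y+ j)) {{subst Positive (sym (coeffSum-y+ j)) (ℚP.normalize-pos (suc j) 1)}})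

  ΠY-≉0 : ∀ {p} j → p ≋ ΠY j → ¬ p ≈P []
  ΠY-≉0 {p} j p≋ΠY p≈0 =
    ℚP.<-irrefl refl (subst (0ℚ <ℚ_) coeffSum≡0 (ℚP.positive⁻¹ _ {{coeffSum-ΠY-positive j}}))
    where
    coeffSum≡0 : coeffSum (ΠY j) ≡ 0ℚ
    coeffSum≡0 = trans (sym (lin-≡ p≋ΠY (λ _ → 1ℚ))) (lin-≈P[] (λ _ → 1ℚ) p p≈0)

  ∑-mix : ∀ {m} (b : Fin m → Poly n) (u v : Poly n) (q q′ : Fin m → Poly n) →
          ∑[ i < m ] (b i *ₚ (u *ₚ q i +ₚ v *ₚ q′ i))
            ≋ u *ₚ ∑[ i < m ] (b i *ₚ q i) +ₚ v *ₚ ∑[ i < m ] (b i *ₚ q′ i)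
  ∑-mix {m} b u v q q′ = begin
    ∑[ i < m ] (b i *ₚ (u *ₚ q i +ₚ v *ₚ q′ i))
      ≈⟨ sum-cong-≋ (λ i → solve 5 (λ b u v q q′ → b :* (u :* q :+ v :* q′) := u :* (b :* q) :+ v :* (b :* q′))
                                  ≋-refl (b i) u v (q i) (q′ i)) ⟩
    ∑[ i < m ] (u *ₚ (b i *ₚ q i) +ₚ v *ₚ (b i *ₚ q′ i))
      ≈⟨ ∑-distrib-+ (λ i → u *ₚ (b i *ₚ q i)) (λ i → v *ₚ (b i *ₚ q′ i)) ⟩
    ∑[ i < m ] (u *ₚ (b i *ₚ q i)) +ₚ ∑[ i < m ] (v *ₚ (b i *ₚ q′ i))
      ≈⟨ padd-cong (*-distribˡ-sum u (λ i → b i *ₚ q i)) (*-distribˡ-sum v (λ i → b i *ₚ q′ i)) ⟨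
    u *ₚ ∑[ i < m ] (b i *ₚ q i) +ₚ v *ₚ ∑[ i < m ] (b i *ₚ q′ i) ∎

  linForm : ∀ {m} → Vec ℕ m → (Fin m → Poly n) → Poly n
  linForm {m} αs x = ∑[ i < m ] (lookupV αs i ×ₚ 1P *ₚ x i)

  module Grid (B : ℕ) where

    D : Poly n
    D = ΠY (suc B)

    -- A variable x with coefficient α is removed from the cofactor of y + k + αx + S
    -- by interpolating between x = 0 (shift k) and x = 1 (shift k + α); `jump` is the
    -- multiple of x² − x that this leaves over.  Shifts are clamped at B to keep the
    -- tables finite (only k + Σα ≤ B is used), and α = 0 costs nothing, so the circuits
    -- grow with Σα rather than with the number of variables.
    mix : ℕ → Poly n → (ℕ → Poly n) → ℕ → Poly n
    mix zero      x h k = h k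
    mix α@(suc _) x h k = (1P +ₚ −1ₚ *ₚ x) *ₚ h k +ₚ x *ₚ h ((k + α) ⊓ B)

    jump : ℕ → (ℕ → Poly n) → ℕ → Poly n
    jump zero      h k = []
    jump α@(suc _) h k = α ×ₚ 1P *ₚ (h ((k + α) ⊓ B) +ₚ −1ₚ *ₚ h k)

    cofactor : ∀ {m} → Vec ℕ m → (Fin m → Poly n) → ℕ → Poly n
    cofactor []       x k = ΠY-without k (suc B)
    cofactor (α ∷ αs) x   = mix α (x zero) (cofactor αs (x ∘ suc))

    correction : ∀ {m} → Vec ℕ m → (Fin m → Poly n) → Fin m → ℕ → Poly n
    correction (α ∷ αs) x zero    = jump α (cofactor αs (x ∘ suc))
    correction (α ∷ αs) x (suc i) = mix α (x zero) (correction αs (x ∘ suc) i)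

    mix-step : ∀ {m} α x S (h : ℕ → Poly n) (b : Fin m → Poly n) (qs : Fin m → ℕ → Poly n) k →
      (k + α) ⊓ B ≡ k + α →
      (y+ k +ₚ S) *ₚ h k ≋ D +ₚ ∑[ i < m ] (b i *ₚ qs i k) →
      (y+ (k + α) +ₚ S) *ₚ h (k + α) ≋ D +ₚ ∑[ i < m ] (b i *ₚ qs i (k + α)) →
      (y+ k +ₚ (α ×ₚ 1P *ₚ x +ₚ S)) *ₚ mix α x h k
        ≋ D +ₚ (boolAxiom x *ₚ jump α h k +ₚ ∑[ i < m ] (b i *ₚ mix α x (qs i) k))
    mix-step {m} zero x S h b qs k _ eqₖ _ = begin
      (y+ k +ₚ S) *ₚ h k                          ≈⟨ eqₖ ⟩
      D +ₚ R                                      ≈⟨ padd-congˡ D (padd-congʳ R (pmul-zeroʳ (boolAxiom x))) ⟨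
      D +ₚ (boolAxiom x *ₚ [] +ₚ R)               ∎
      where R = ∑[ i < m ] (b i *ₚ qs i k)
    mix-step {m} α@(suc _) x S h b qs k clamped eqₖ eqₖ₊α rewrite clamped = begin
      (y+ k +ₚ (N *ₚ x +ₚ S)) *ₚ ((1P +ₚ −1ₚ *ₚ x) *ₚ h₀ +ₚ x *ₚ h₁)
        ≈⟨ solve 6 (λ a N x S h₀ h₁ →
               (a :+ (N :* x :+ S)) :* ((con 1ℚ :+ con (-ℚ 1ℚ) :* x) :* h₀ :+ x :* h₁)
             := ((con 1ℚ :+ con (-ℚ 1ℚ) :* x) :* ((a :+ S) :* h₀) :+ x :* ((a :+ N :+ S) :* h₁))
                :+ (x :* x :+ :- x) :* (N :* (h₁ :+ con (-ℚ 1ℚ) :* h₀)))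
             ≋-refl (y+ k) N x S h₀ h₁ ⟩
      ((1P +ₚ −1ₚ *ₚ x) *ₚ ((y+ k +ₚ S) *ₚ h₀) +ₚ x *ₚ ((y+ k +ₚ N +ₚ S) *ₚ h₁)) +ₚ Z
        ≈⟨ padd-congʳ Z (padd-cong (pmul-congˡ (1P +ₚ −1ₚ *ₚ x) eqₖ)
                                   (pmul-congˡ x (≋-trans (pmul-congʳ h₁ (padd-congʳ S (≋-sym (y+-+ k α)))) eqₖ₊α))) ⟩
      ((1P +ₚ −1ₚ *ₚ x) *ₚ (D +ₚ R₀) +ₚ x *ₚ (D +ₚ R₁)) +ₚ Z
        ≈⟨ solve 5 (λ x D R₀ R₁ Z →
               ((con 1ℚ :+ con (-ℚ 1ℚ) :* x) :* (D :+ R₀) :+ x :* (D :+ R₁)) :+ Z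
             := D :+ (Z :+ ((con 1ℚ :+ con (-ℚ 1ℚ) :* x) :* R₀ :+ x :* R₁)))
             ≋-refl x D R₀ R₁ Z ⟩
      D +ₚ (Z +ₚ ((1P +ₚ −1ₚ *ₚ x) *ₚ R₀ +ₚ x *ₚ R₁))
        ≈⟨ padd-congˡ D (padd-congˡ Z (∑-mix b (1P +ₚ −1ₚ *ₚ x) x (λ i → qs i k) (λ i → qs i (k + α)))) ⟨
      D +ₚ (Z +ₚ ∑[ i < m ] (b i *ₚ ((1P +ₚ −1ₚ *ₚ x) *ₚ qs i k +ₚ x *ₚ qs i (k + α)))) ∎
      where
      N  = α ×ₚ 1P
      h₀ = h k
      h₁ = h (k + α)
      R₀ = ∑[ i < m ] (b i *ₚ qs i k)
      R₁ = ∑[ i < m ] (b i *ₚ qs i (k + α))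
      Z  = boolAxiom x *ₚ (N *ₚ (h₁ +ₚ −1ₚ *ₚ h₀))

    certificate-identity : ∀ {m} (αs : Vec ℕ m) (x : Fin m → Poly n) k → k + sumV αs ≤ B →
      (y+ k +ₚ linForm αs x) *ₚ cofactor αs x k ≋ D +ₚ ∑[ i < m ] (boolAxiom (x i) *ₚ correction αs x i k)
    certificate-identity [] x k k≤B = begin
      (y+ k +ₚ []) *ₚ ΠY-without k (suc B)   ≈⟨ pmul-congʳ (ΠY-without k (suc B)) (padd-identityʳ (y+ k)) ⟩
      y+ k *ₚ ΠY-without k (suc B)           ≈⟨ y+*ΠY-without k (suc B) (s≤s (ℕP.≤-trans (ℕP.m≤m+n k 0) k≤B)) ⟩
      D                                      ≈⟨ padd-identityʳ D ⟨
      D +ₚ []                                ∎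
    certificate-identity (α ∷ αs) x k bound =
      mix-step α (x zero) (linForm αs (x ∘ suc)) (cofactor αs (x ∘ suc)) (boolAxiom ∘ x ∘ suc) (correction αs (x ∘ suc)) k
        (ℕP.m≤n⇒m⊓n≡m (ℕP.≤-trans (ℕP.m≤m+n (k + α) (sumV αs)) bound′))
        (certificate-identity αs (x ∘ suc) k (ℕP.≤-trans (ℕP.+-monoʳ-≤ k (ℕP.m≤n+m (sumV αs) α)) bound))
        (certificate-identity αs (x ∘ suc) (k + α) bound′)
      where
      bound′ : k + α + sumV αs ≤ B
      bound′ = subst (_≤ B) (sym (ℕP.+-assoc k α (sumV αs))) bound

-- Straight-line programs

clamp : (t j : ℕ) → Fin (suc t)
clamp t       zero    = zero
clamp zero    (suc j) = zero
clamp (suc t) (suc j) = suc (clamp t j)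

-- Node p, counted from the first node, of a program whose last node is node t.
-- (Gates of an SLP refer to earlier nodes counted backwards from the newest.)
ref : (t p : ℕ) → Fin (suc t)
ref t p = clamp t (t ∸ p)

ref-old : ∀ {t p} → p ≤ t → ref (suc t) p ≡ suc (ref t p)
ref-old {t} {p} p≤t rewrite ℕP.+-∸-assoc 1 p≤t = refl

module Builder (n : ℕ) where

  data Instr : Set where
    var : Fin n → Instr
    c0 c1 cm1 cy : Instr
    add mul : ℕ → ℕ → Instr

  toGate : ∀ t → Instr → Gate n (suc t)
  toGate t (var i)   = var i
  toGate t c0        = c0
  toGate t c1        = c1
  toGate t cm1       = cm1
  toGate t cy        = cy
  toGate t (add u v) = add (ref t u) (ref t v)
  toGate t (mul u v) = mul (ref t u) (ref t v)

  toGate-ok : ∀ {t} (c : SLP n (suc t)) i → GateOK c (toGate t i)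
  toGate-ok c (var _)   = tt
  toGate-ok c c0        = tt
  toGate-ok c c1        = tt
  toGate-ok c cm1       = tt
  toGate-ok c cy        = tt
  toGate-ok c (add _ _) = tt
  toGate-ok c (mul _ _) = tt

  record Prog : Set where
    constructor prog
    field
      top : ℕ
      slp : SLP n (suc top)
      wf  : WF slp
  open Prog public

  emit : Prog → Instr → Prog
  emit (prog t c w) i = prog (suc t) (c ▷ toGate t i) (w , toGate-ok c i)

  at : Prog → ℕ → RF n
  at P p = val (slp P) (ref (top P) p)

  at-old : ∀ P i {p} → p ≤ top P → at (emit P i) p ≡ at P p
  at-old (prog t c w) i p≤top rewrite ref-old p≤top = refl

  at-new : ∀ P i → at (emit P i) (suc (top P)) ≡ gateVal (slp P) (toGate (top P) i)
  at-new (prog t c w) i rewrite ℕP.n∸n≡0 t = refl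

  XFree : Prog → ℕ → Set
  XFree P p = p ≤ top P × noX (slp P) (ref (top P) p) ≡ true

  record Holds (P : Prog) (p : ℕ) (s : Poly n) : Set where
    constructor holds
    field
      inRange : p ≤ top P
      num≋    : proj₁ (at P p) ≋ s
      den≋    : proj₂ (at P p) ≋ 1P
  open Holds public

  Holds-cong : ∀ {P p s t} → s ≋ t → Holds P p s → Holds P p t
  Holds-cong s≋t (holds r n d) = holds r (≋-trans n s≋t) d

  record _⊑_ (P Q : Prog) : Set where
    field
      keeps      : ∀ {p s} → Holds P p s → Holds Q p s
      keepsXFree : ∀ {p} → XFree P p → XFree Q p
  open _⊑_ public

  ⊑-refl : ∀ {P} → P ⊑ P
  ⊑-refl = record { keeps = λ h → h ; keepsXFree = λ x → x }

  ⊑-trans : ∀ {P Q R} → P ⊑ Q → Q ⊑ R → P ⊑ R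
  ⊑-trans P⊑Q Q⊑R = record
    { keeps = λ h → keeps Q⊑R (keeps P⊑Q h) ; keepsXFree = λ x → keepsXFree Q⊑R (keepsXFree P⊑Q x) }

  emit-⊑ : ∀ P i → P ⊑ emit P i
  emit-⊑ P@(prog t c w) i = record
    { keeps = λ { (holds p≤t n d) → holds (ℕP.m≤n⇒m≤1+n p≤t)
                    (subst (λ v → proj₁ v ≋ _) (sym (at-old P i p≤t)) n)
                    (subst (λ v → proj₂ v ≋ 1P) (sym (at-old P i p≤t)) d) }
    ; keepsXFree = λ { (p≤t , x) → ℕP.m≤n⇒m≤1+n p≤t , trans (noX-old p≤t) x } }
    where
    noX-old : ∀ {p} → p ≤ t → noX (c ▷ toGate t i) (ref (suc t) p) ≡ noX c (ref t p)
    noX-old p≤t rewrite ref-old p≤t = refl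

  record _⊑⟨_⟩_ (P : Prog) (c : ℕ) (Q : Prog) : Set where
    constructor extends
    field
      prefix : P ⊑ Q
      growth : top Q ≤ top P + c
  open _⊑⟨_⟩_ public

  ⊑⟨⟩-refl : ∀ {P} → P ⊑⟨ 0 ⟩ P
  ⊑⟨⟩-refl {P} = extends ⊑-refl (ℕP.m≤m+n (top P) 0)

  ⊑⟨⟩-trans : ∀ {P Q R c d} → P ⊑⟨ c ⟩ Q → Q ⊑⟨ d ⟩ R → P ⊑⟨ c + d ⟩ R
  ⊑⟨⟩-trans {P} {c = c} {d} (extends P⊑Q gQ) (extends Q⊑R gR) = extends (⊑-trans P⊑Q Q⊑R)
    (ℕP.≤-trans gR (ℕP.≤-trans (ℕP.+-monoˡ-≤ d gQ) (ℕP.≤-reflexive (ℕP.+-assoc (top P) c d))))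

  ⊑⟨⟩-weaken : ∀ {P Q c d} → c ≤ d → P ⊑⟨ c ⟩ Q → P ⊑⟨ d ⟩ Q
  ⊑⟨⟩-weaken {P} c≤d (extends P⊑Q g) = extends P⊑Q (ℕP.≤-trans g (ℕP.+-monoʳ-≤ (top P) c≤d))

  emit-⊑⟨1⟩ : ∀ P i → P ⊑⟨ 1 ⟩ emit P i
  emit-⊑⟨1⟩ P i = extends (emit-⊑ P i) (ℕP.≤-reflexive (ℕP.+-comm 1 (top P)))

  ⊑⟨⟩-emit : ∀ {P Q c} → P ⊑⟨ c ⟩ Q → ∀ i → P ⊑⟨ suc c ⟩ emit Q i
  ⊑⟨⟩-emit {Q = Q} {c} P⊑Q i = ⊑⟨⟩-weaken (ℕP.≤-reflexive (ℕP.+-comm c 1)) (⊑⟨⟩-trans P⊑Q (emit-⊑⟨1⟩ Q i))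

  private
    holds-new : ∀ P i s → proj₁ (gateVal (slp P) (toGate (top P) i)) ≋ s →
                proj₂ (gateVal (slp P) (toGate (top P) i)) ≋ 1P → Holds (emit P i) (suc (top P)) s
    holds-new P i s n d = holds ℕP.≤-refl (subst (λ v → proj₁ v ≋ s) (sym (at-new P i)) n)
                                          (subst (λ v → proj₂ v ≋ 1P) (sym (at-new P i)) d)

  emit-var : ∀ P i → Holds (emit P (var i)) (suc (top P)) (pX i)
  emit-var P i = holds-new P (var i) _ ≋-refl ≋-refl

  emit-c0 : ∀ P → Holds (emit P c0) (suc (top P)) (pconst 0ℚ)
  emit-c0 P = holds-new P c0 _ ≋-refl ≋-refl

  emit-cm1 : ∀ P → Holds (emit P cm1) (suc (top P)) (pconst (-ℚ 1ℚ))
  emit-cm1 P = holds-new P cm1 _ ≋-refl ≋-refl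

  emit-cy : ∀ P → Holds (emit P cy) (suc (top P)) pY
  emit-cy P = holds-new P cy _ ≋-refl ≋-refl

  emit-add : ∀ P {u v s t} → Holds P u s → Holds P v t → Holds (emit P (add u v)) (suc (top P)) (padd s t)
  emit-add P {u} {v} {s} {t} (holds _ nᵤ dᵤ) (holds _ nᵥ dᵥ) = holds-new P (add u v) (padd s t)
    (padd-cong (≋-trans (pmul-cong nᵤ dᵥ) (pmul-identityʳ s)) (≋-trans (pmul-cong nᵥ dᵤ) (pmul-identityʳ t)))
    (≋-trans (pmul-cong dᵤ dᵥ) (pmul-identityʳ 1P))

  emit-mul : ∀ P {u v s t} → Holds P u s → Holds P v t → Holds (emit P (mul u v)) (suc (top P)) (pmul s t)
  emit-mul P {u} {v} {s} {t} (holds _ nᵤ dᵤ) (holds _ nᵥ dᵥ) = holds-new P (mul u v) (pmul s t)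
    (pmul-cong nᵤ nᵥ)
    (≋-trans (pmul-cong dᵤ dᵥ) (pmul-identityʳ 1P))

  private
    xFree-new : ∀ P i → gateNoX (slp P) (toGate (top P) i) ≡ true → XFree (emit P i) (suc (top P))
    xFree-new (prog t c w) i x rewrite ℕP.n∸n≡0 t = ℕP.≤-refl , x

  emit-cy-xFree : ∀ P → XFree (emit P cy) (suc (top P))
  emit-cy-xFree P = xFree-new P cy refl

  emit-add-xFree : ∀ P {u v} → XFree P u → XFree P v → XFree (emit P (add u v)) (suc (top P))
  emit-add-xFree P {u} {v} (_ , xᵤ) (_ , xᵥ) = xFree-new P (add u v) (cong₂ _∧_ xᵤ xᵥ)

  emit-mul-xFree : ∀ P {u v} → XFree P u → XFree P v → XFree (emit P (mul u v)) (suc (top P))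
  emit-mul-xFree P {u} {v} (_ , xᵤ) (_ , xᵥ) = xFree-new P (mul u v) (cong₂ _∧_ xᵤ xᵥ)

-- Circuits for the cofactor and correction tables

module Circuits {n : ℕ} (B : ℕ) where
  open Grid {n} B
  open Builder n
  open CommutativeRing (polyRing {n}) using (semiring) renaming (_+_ to _+ₚ_; _*_ to _*ₚ_)
  open import Algebra.Properties.Semiring.Mult semiring using () renaming (_×_ to _×ₚ_)

  record Consts (P : Prog) : Set where
    field
      one      : Holds P 0 1P
      minusOne : Holds P 1 −1ₚ
      nought    : Holds P 2 []
      shiftY      : ∀ k → k ≤ B → Holds P (3 + k) (y+ k)
      one-xFree : XFree P 0
      shiftY-xFree : ∀ k → k ≤ B → XFree P (3 + k)
  open Consts public

  Consts-mono : ∀ {P Q} → P ⊑ Q → Consts P → Consts Q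
  Consts-mono P⊑Q c = record
    { one = keeps P⊑Q (one c) ; minusOne = keeps P⊑Q (minusOne c) ; nought = keeps P⊑Q (nought c)
    ; shiftY = λ k k≤B → keeps P⊑Q (shiftY c k k≤B)
    ; one-xFree = keepsXFree P⊑Q (one-xFree c) ; shiftY-xFree = λ k k≤B → keepsXFree P⊑Q (shiftY-xFree c k k≤B) }

  Table : Prog → (ℕ → ℕ) → (ℕ → Poly n) → Set
  Table P t h = ∀ k → k ≤ B → Holds P (t k) (h k)

  Table-mono : ∀ {P Q t h} → P ⊑ Q → Table P t h → Table Q t h
  Table-mono P⊑Q tbl k k≤B = keeps P⊑Q (tbl k k≤B)

  record BuildsNode (P : Prog) (c : ℕ) (s : Poly n) (r : Prog × ℕ) : Set where
    constructor buildsNode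
    field
      extension : P ⊑⟨ c ⟩ proj₁ r
      result    : Holds (proj₁ r) (proj₂ r) s
  open BuildsNode public

  record BuildsTable (P : Prog) (c : ℕ) (h : ℕ → Poly n) (r : Prog × (ℕ → ℕ)) : Set where
    constructor buildsTable
    field
      extension : P ⊑⟨ c ⟩ proj₁ r
      table     : Table (proj₁ r) (proj₂ r) h
  open BuildsTable public

  _[_≔_] : (ℕ → ℕ) → ℕ → ℕ → ℕ → ℕ
  (t [ K ≔ r ]) k with k ℕ.≟ K
  ... | yes _ = r
  ... | no _  = t k

  Step : Set
  Step = ℕ → Prog → Prog × ℕ

  private
    loop : ℕ → Step → Prog → Prog × (ℕ → ℕ)
    loop zero    step P = P , λ _ → 0
    loop (suc K) step P = let (Q , t) = loop K step P ; (R , r) = step K Q in R , t [ K ≔ r ]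

    loop-ok : ∀ (Inv : Prog → Set) → (∀ {P Q} → P ⊑ Q → Inv P → Inv Q) →
      (step : Step) (h : ℕ → Poly n) (c K : ℕ) → (∀ k Q → k < K → Inv Q → BuildsNode Q c (h k) (step k Q)) →
      ∀ P → Inv P →
      P ⊑⟨ K * c ⟩ proj₁ (loop K step P) × (∀ k → k < K → Holds (proj₁ (loop K step P)) (proj₂ (loop K step P) k) (h k))
    loop-ok Inv mono step h c zero stepOk P inv = ⊑⟨⟩-refl , λ _ ()
    loop-ok Inv mono step h c (suc K) stepOk P inv =
      ⊑⟨⟩-weaken (ℕP.≤-reflexive (ℕP.+-comm (K * c) c)) (⊑⟨⟩-trans P⊑Q Q⊑R) , tbl
      where
      previous = loop-ok Inv mono step h c K (λ k Q k<K → stepOk k Q (ℕP.m<n⇒m<1+n k<K)) P inv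
      P⊑Q = proj₁ previous
      new = stepOk K (proj₁ (loop K step P)) ℕP.≤-refl (mono (prefix P⊑Q) inv)
      Q⊑R = extension new
      tbl : ∀ k → k < suc K → Holds (proj₁ (loop (suc K) step P)) (proj₂ (loop (suc K) step P) k) (h k)
      tbl k k<1+K with k ℕ.≟ K
      ... | yes refl = result new
      ... | no k≢K   = keeps (prefix Q⊑R) (proj₂ previous k (ℕP.≤∧≢⇒< (ℕP.≤-pred k<1+K) k≢K))

  forEach : Step → Prog → Prog × (ℕ → ℕ)
  forEach = loop (suc B)

  forEach-ok : ∀ (Inv : Prog → Set) → (∀ {P Q} → P ⊑ Q → Inv P → Inv Q) →
    (step : Step) (h : ℕ → Poly n) (c : ℕ) → (∀ k Q → k ≤ B → Inv Q → BuildsNode Q c (h k) (step k Q)) →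
    ∀ P → Inv P → BuildsTable P (suc B * c) h (forEach step P)
  forEach-ok Inv mono step h c stepOk P inv =
    let (ext , tbl) = loop-ok Inv mono step h c (suc B) (λ k Q k<1+B → stepOk k Q (ℕP.≤-pred k<1+B)) P inv
    in buildsTable ext (λ k k≤B → tbl k (s≤s k≤B))

  natNode : ℕ → Prog → Prog × ℕ
  natNode zero    P = P , 2
  natNode (suc j) P = let (Q , p) = natNode j P in emit Q (add 0 p) , suc (top Q)

  natNode-ok : ∀ j P → Consts P → BuildsNode P j (j ×ₚ 1P) (natNode j P)
  natNode-ok zero    P cs = buildsNode ⊑⟨⟩-refl (nought cs)
  natNode-ok (suc j) P cs = buildsNode
    (⊑⟨⟩-emit (extension previous) (add 0 p))
    (emit-add Q (one (Consts-mono (prefix (extension previous)) cs)) (result previous))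
    where
    previous = natNode-ok j P cs
    Q = proj₁ (natNode j P)
    p = proj₂ (natNode j P)

  ΠY-withoutNode : ℕ → ℕ → Prog → Prog × ℕ
  ΠY-withoutNode k zero P = P , 0
  ΠY-withoutNode k (suc j) P with j ℕ.≟ k
  ... | yes _ = ΠY-withoutNode k j P
  ... | no _  = let (Q , p) = ΠY-withoutNode k j P in emit Q (mul p (3 + j)) , suc (top Q)

  ΠY-withoutNode-ok : ∀ k j P → j ≤ suc B → Consts P → BuildsNode P j (ΠY-without k j) (ΠY-withoutNode k j P)
  ΠY-withoutNode-ok k zero P _ cs = buildsNode ⊑⟨⟩-refl (one cs)
  ΠY-withoutNode-ok k (suc j) P j<1+B cs with j ℕ.≟ k
  ... | yes _ = buildsNode (⊑⟨⟩-weaken (ℕP.n≤1+n j) (extension previous)) (result previous)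
    where previous = ΠY-withoutNode-ok k j P (ℕP.<⇒≤ j<1+B) cs
  ... | no _ = buildsNode
    (⊑⟨⟩-emit (extension previous) (mul p (3 + j)))
    (emit-mul Q (result previous) (shiftY (Consts-mono (prefix (extension previous)) cs) j (ℕP.≤-pred j<1+B)))
    where
    previous = ΠY-withoutNode-ok k j P (ℕP.<⇒≤ j<1+B) cs
    Q = proj₁ (ΠY-withoutNode k j P)
    p = proj₂ (ΠY-withoutNode k j P)

  ΠYNode : ℕ → Prog → Prog × ℕ
  ΠYNode zero    P = P , 0
  ΠYNode (suc j) P = let (Q , p) = ΠYNode j P in emit Q (mul p (3 + j)) , suc (top Q)

  ΠYNode-ok : ∀ j P → j ≤ suc B → Consts P →
    BuildsNode P j (ΠY j) (ΠYNode j P) × XFree (proj₁ (ΠYNode j P)) (proj₂ (ΠYNode j P))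
  ΠYNode-ok zero P _ cs = buildsNode ⊑⟨⟩-refl (one cs) , one-xFree cs
  ΠYNode-ok (suc j) P j<1+B cs =
    buildsNode (⊑⟨⟩-emit (extension previous) (mul p (3 + j)))
               (emit-mul Q (result previous) (shiftY csQ j (ℕP.≤-pred j<1+B))) ,
    emit-mul-xFree Q xFree-p (shiftY-xFree csQ j (ℕP.≤-pred j<1+B))
    where
    IH = ΠYNode-ok j P (ℕP.<⇒≤ j<1+B) cs
    previous = proj₁ IH
    xFree-p = proj₂ IH
    Q = proj₁ (ΠYNode j P)
    p = proj₂ (ΠYNode j P)
    csQ = Consts-mono (prefix (extension previous)) cs

  levelCost : ℕ
  levelCost = 3 + suc B * 3

  mixStep : ℕ → ℕ → (ℕ → ℕ) → Step
  mixStep α xPos t k R =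
    emit (emit (emit R (mul (2 + xPos) (t k))) (mul xPos (t ((k + α) ⊓ B)))) (add (1 + top R) (2 + top R)) , 3 + top R

  mixLevel : ℕ → Fin n → (ℕ → ℕ) → Prog → Prog × (ℕ → ℕ)
  mixLevel zero      xi t P = P , t
  mixLevel α@(suc _) xi t P =
    forEach (mixStep α (1 + top P) t) (emit (emit (emit P (var xi)) (mul 1 (1 + top P))) (add 0 (2 + top P)))

  mixLevel-ok : ∀ α xi t h P → Consts P → Table P t h → BuildsTable P (α * levelCost) (mix α (pX xi) h) (mixLevel α xi t P)
  mixLevel-ok zero      xi t h P cs tbl = buildsTable ⊑⟨⟩-refl tbl
  mixLevel-ok α@(suc j) xi t h P cs tbl =
    let buildsTable ext tbl′ = forEach-ok Inv Inv-mono (mixStep α xPos t) (mix α (pX xi) h) 3 step-ok P₃ inv₃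
    in buildsTable (⊑⟨⟩-weaken (ℕP.m≤m+n levelCost (j * levelCost)) (⊑⟨⟩-trans P⊑⟨3⟩P₃ ext)) tbl′
    where
    xPos = 1 + top P
    P₁ = emit P (var xi)
    P₂ = emit P₁ (mul 1 xPos)
    P₃ = emit P₂ (add 0 (1 + xPos))
    P⊑⟨3⟩P₃ : P ⊑⟨ 3 ⟩ P₃
    P⊑⟨3⟩P₃ = ⊑⟨⟩-emit (⊑⟨⟩-emit (emit-⊑⟨1⟩ P (var xi)) (mul 1 xPos)) (add 0 (1 + xPos))
    Inv : Prog → Set
    Inv R = Consts R × Table R t h × Holds R xPos (pX xi) × Holds R (2 + xPos) (1P +ₚ −1ₚ *ₚ pX xi)
    Inv-mono : ∀ {R S} → R ⊑ S → Inv R → Inv S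
    Inv-mono R⊑S (cs , tbl , hx , h1-x) = Consts-mono R⊑S cs , Table-mono R⊑S tbl , keeps R⊑S hx , keeps R⊑S h1-x
    inv₃ : Inv P₃
    inv₃ = Consts-mono (prefix P⊑⟨3⟩P₃) cs , Table-mono (prefix P⊑⟨3⟩P₃) tbl ,
           keeps (⊑-trans (emit-⊑ P₁ (mul 1 xPos)) (emit-⊑ P₂ (add 0 (1 + xPos)))) hx ,
           emit-add P₂ (keeps (⊑-trans (emit-⊑ P (var xi)) (emit-⊑ P₁ (mul 1 xPos))) (one cs))
                       (emit-mul P₁ (keeps (emit-⊑ P (var xi)) (minusOne cs)) hx)
      where hx = emit-var P xi
    step-ok : ∀ k R → k ≤ B → Inv R → BuildsNode R 3 (mix α (pX xi) h k) (mixStep α xPos t k R)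
    step-ok k R k≤B (csR , tblR , hx , h1-x) = buildsNode
      (⊑⟨⟩-trans (⊑⟨⟩-trans (emit-⊑⟨1⟩ R i₁) (emit-⊑⟨1⟩ R₁ i₂)) (emit-⊑⟨1⟩ R₂ i₃))
      (emit-add R₂ (keeps (emit-⊑ R₁ i₂) (emit-mul R h1-x (tblR k k≤B)))
                   (emit-mul R₁ (keeps (emit-⊑ R i₁) hx) (keeps (emit-⊑ R i₁) (tblR k′ (ℕP.m⊓n≤n (k + α) B)))))
      where
      k′ = (k + α) ⊓ B
      i₁ = mul (2 + xPos) (t k)
      i₂ = mul xPos (t k′)
      i₃ = add (1 + top R) (2 + top R)
      R₁ = emit R i₁
      R₂ = emit R₁ i₂

  jumpStep : ℕ → ℕ → (ℕ → ℕ) → Step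
  jumpStep α αPos t k R =
    emit (emit (emit R (mul 1 (t k))) (add (t ((k + α) ⊓ B)) (1 + top R))) (mul αPos (2 + top R)) , 3 + top R

  jumpLevel : ℕ → (ℕ → ℕ) → Prog → Prog × (ℕ → ℕ)
  jumpLevel zero      t P = P , λ _ → 2
  jumpLevel α@(suc _) t P = let (P₁ , αPos) = natNode α P in forEach (jumpStep α αPos t) P₁

  private
    jumpLevel-cost : ∀ j → suc j + suc B * 3 ≤ suc j * levelCost
    jumpLevel-cost j = subst (suc j + suc B * 3 ≤_) (equation j B) (ℕP.m≤m+n _ _)
      where
      open ℕ-Solver
      equation : ∀ j B → suc j + suc B * 3 + (2 + j * 2 + j * (suc B * 3)) ≡ suc j * (3 + suc B * 3)
      equation = solve 2 (λ j B → con 1 :+ j :+ (con 1 :+ B) :* con 3 :+ (con 2 :+ j :* con 2 :+ j :* ((con 1 :+ B) :* con 3))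
                                  := (con 1 :+ j) :* (con 3 :+ (con 1 :+ B) :* con 3)) refl

  jumpLevel-ok : ∀ α t h P → Consts P → Table P t h → BuildsTable P (α * levelCost) (jump α h) (jumpLevel α t P)
  jumpLevel-ok zero      t h P cs tbl = buildsTable ⊑⟨⟩-refl (λ _ _ → nought cs)
  jumpLevel-ok α@(suc j) t h P cs tbl =
    let buildsTable ext tbl′ = forEach-ok Inv Inv-mono (jumpStep α αPos t) (jump α h) 3 step-ok P₁ inv₁
    in buildsTable (⊑⟨⟩-weaken (jumpLevel-cost j) (⊑⟨⟩-trans (extension natα) ext)) tbl′
    where
    natα = natNode-ok α P cs
    P₁ = proj₁ (natNode α P)
    αPos = proj₂ (natNode α P)
    Inv : Prog → Set
    Inv R = Consts R × Table R t h × Holds R αPos (α ×ₚ 1P)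
    Inv-mono : ∀ {R S} → R ⊑ S → Inv R → Inv S
    Inv-mono R⊑S (cs , tbl , ha) = Consts-mono R⊑S cs , Table-mono R⊑S tbl , keeps R⊑S ha
    inv₁ : Inv P₁
    inv₁ = Consts-mono (prefix (extension natα)) cs , Table-mono (prefix (extension natα)) tbl , result natα
    step-ok : ∀ k R → k ≤ B → Inv R → BuildsNode R 3 (jump α h k) (jumpStep α αPos t k R)
    step-ok k R k≤B (csR , tblR , ha) = buildsNode
      (⊑⟨⟩-trans (⊑⟨⟩-trans (emit-⊑⟨1⟩ R i₁) (emit-⊑⟨1⟩ R₁ i₂)) (emit-⊑⟨1⟩ R₂ i₃))
      (emit-mul R₂ (keeps (⊑-trans (emit-⊑ R i₁) (emit-⊑ R₁ i₂)) ha)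
                   (emit-add R₁ (keeps (emit-⊑ R i₁) (tblR k′ (ℕP.m⊓n≤n (k + α) B)))
                                (emit-mul R (minusOne csR) (tblR k k≤B))))
      where
      k′ = (k + α) ⊓ B
      i₁ = mul 1 (t k)
      i₂ = add (t k′) (1 + top R)
      i₃ = mul αPos (2 + top R)
      R₁ = emit R i₁
      R₂ = emit R₁ i₂

  gridCost : ℕ → ℕ
  gridCost s = suc B * suc B + s * levelCost

  private
    gridCost-+ : ∀ α s → gridCost s + α * levelCost ≡ gridCost (α + s)
    gridCost-+ α s = solve 4 (λ b s α l → b :+ s :* l :+ α :* l := b :+ (α :+ s) :* l) refl (suc B * suc B) s α levelCost
      where open ℕ-Solver

    extend-level : ∀ {P Q R α s} → P ⊑⟨ gridCost s ⟩ Q → Q ⊑⟨ α * levelCost ⟩ R → P ⊑⟨ gridCost (α + s) ⟩ R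
    extend-level {α = α} {s} P⊑Q Q⊑R = ⊑⟨⟩-weaken (ℕP.≤-reflexive (gridCost-+ α s)) (⊑⟨⟩-trans P⊑Q Q⊑R)

  cofactorTable : ∀ {m} → Vec ℕ m → (Fin m → Fin n) → Prog → Prog × (ℕ → ℕ)
  cofactorTable []       ι P = forEach (λ k → ΠY-withoutNode k (suc B)) P
  cofactorTable (α ∷ αs) ι P = let (Q , t) = cofactorTable αs (ι ∘ suc) P in mixLevel α (ι zero) t Q

  cofactorTable-ok : ∀ {m} αs (ι : Fin m → Fin n) P → Consts P →
    BuildsTable P (gridCost (sumV αs)) (cofactor αs (pX ∘ ι)) (cofactorTable αs ι P)
  cofactorTable-ok [] ι P cs =
    let buildsTable ext tbl = forEach-ok Consts Consts-mono (λ k → ΠY-withoutNode k (suc B)) (λ k → ΠY-without k (suc B)) (suc B)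
                                (λ k Q _ csQ → ΠY-withoutNode-ok k (suc B) Q ℕP.≤-refl csQ) P cs
    in buildsTable (⊑⟨⟩-weaken (ℕP.m≤m+n _ 0) ext) tbl
  cofactorTable-ok (α ∷ αs) ι P cs =
    let buildsTable ext tbl = cofactorTable-ok αs (ι ∘ suc) P cs
        buildsTable ext′ tbl′ = mixLevel-ok α (ι zero) _ _ _ (Consts-mono (prefix ext) cs) tbl
    in buildsTable (extend-level {α = α} {sumV αs} ext ext′) tbl′

  correctionTable : ∀ {m} → Vec ℕ m → (Fin m → Fin n) → Fin m → Prog → Prog × (ℕ → ℕ)
  correctionTable (α ∷ αs) ι zero    P = let (Q , t) = cofactorTable αs (ι ∘ suc) P in jumpLevel α t Q
  correctionTable (α ∷ αs) ι (suc i) P = let (Q , t) = correctionTable αs (ι ∘ suc) i P in mixLevel α (ι zero) t Q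

  correctionTable-ok : ∀ {m} αs (ι : Fin m → Fin n) i P → Consts P →
    BuildsTable P (gridCost (sumV αs)) (correction αs (pX ∘ ι) i) (correctionTable αs ι i P)
  correctionTable-ok (α ∷ αs) ι zero P cs =
    let buildsTable ext tbl = cofactorTable-ok αs (ι ∘ suc) P cs
        buildsTable ext′ tbl′ = jumpLevel-ok α _ _ _ (Consts-mono (prefix ext) cs) tbl
    in buildsTable (extend-level {α = α} {sumV αs} ext ext′) tbl′
  correctionTable-ok (α ∷ αs) ι (suc i) P cs =
    let buildsTable ext tbl = correctionTable-ok αs (ι ∘ suc) i P cs
        buildsTable ext′ tbl′ = mixLevel-ok α (ι zero) _ _ _ (Consts-mono (prefix ext) cs) tbl
    in buildsTable (extend-level {α = α} {sumV αs} ext ext′) tbl′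

  private
    P₀ P₁ P₂ : Prog
    P₀ = prog 0 ([] ▷ c1) (tt , tt)
    P₁ = emit P₀ cm1
    P₂ = emit P₁ c0

  constants : Prog
  constants = emit P₂ cy

  private
    P₀⊑constants : P₀ ⊑ constants
    P₀⊑constants = ⊑-trans (emit-⊑ P₀ cm1) (⊑-trans (emit-⊑ P₁ c0) (emit-⊑ P₂ cy))

  yNodes : ℕ → Prog
  yNodes zero    = constants
  yNodes (suc k) = emit (yNodes k) (add (3 + k) 0)

  top-yNodes : ∀ k → top (yNodes k) ≡ 3 + k
  top-yNodes zero    = refl
  top-yNodes (suc k) = cong suc (top-yNodes k)

  yNodes-ok : ∀ K → constants ⊑ yNodes K × (∀ j → j ≤ K → Holds (yNodes K) (3 + j) (y+ j) × XFree (yNodes K) (3 + j))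
  yNodes-ok zero = ⊑-refl , λ { zero z≤n → Holds-cong (≋-sym (padd-identityʳ pY)) (emit-cy P₂) , emit-cy-xFree P₂ }
  yNodes-ok (suc K) = ⊑-trans c⊑R (emit-⊑ R i) , nodes
    where
    R = yNodes K
    i = add (3 + K) 0
    c⊑R = proj₁ (yNodes-ok K)
    P₀⊑R = ⊑-trans P₀⊑constants c⊑R
    y+-suc : y+ K +ₚ 1P ≋ y+ (suc K)
    y+-suc = ≋-trans (padd-assoc pY (K ×ₚ 1P) 1P) (padd-congˡ pY (padd-comm (K ×ₚ 1P) 1P))
    nodes : ∀ j → j ≤ suc K → Holds (emit R i) (3 + j) (y+ j) × XFree (emit R i) (3 + j)
    nodes j j≤1+K with j ℕ.≟ suc K
    ... | yes refl =
      subst (λ p → Holds (emit R i) p (y+ (suc K)) × XFree (emit R i) p) (cong suc (top-yNodes K))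
        ( Holds-cong y+-suc (emit-add R (proj₁ (proj₂ (yNodes-ok K) K ℕP.≤-refl)) (keeps P₀⊑R (holds z≤n ≋-refl ≋-refl)))
        , emit-add-xFree R (proj₂ (proj₂ (yNodes-ok K) K ℕP.≤-refl)) (keepsXFree P₀⊑R (z≤n , refl)))
    ... | no j≢1+K =
      let (h , x) = proj₂ (yNodes-ok K) j (ℕP.≤-pred (ℕP.≤∧≢⇒< j≤1+K j≢1+K))
      in keeps (emit-⊑ R i) h , keepsXFree (emit-⊑ R i) x

  yNodes-consts : Consts (yNodes B)
  yNodes-consts = record
    { one       = keeps P₀⊑Y (holds z≤n ≋-refl ≋-refl)
    ; minusOne  = keeps (⊑-trans (⊑-trans (emit-⊑ P₁ c0) (emit-⊑ P₂ cy)) c⊑Y) (emit-cm1 P₀)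
    ; nought     = Holds-cong pconst-0 (keeps (⊑-trans (emit-⊑ P₂ cy) c⊑Y) (emit-c0 P₁))
    ; shiftY       = λ k k≤B → proj₁ (proj₂ (yNodes-ok B) k k≤B)
    ; one-xFree = keepsXFree P₀⊑Y (z≤n , refl)
    ; shiftY-xFree = λ k k≤B → proj₂ (proj₂ (yNodes-ok B) k k≤B) }
    where
    c⊑Y = proj₁ (yNodes-ok B)
    P₀⊑Y = ⊑-trans P₀⊑constants c⊑Y

  shared : Prog
  shared = proj₁ (ΠYNode (suc B) (yNodes B))

  D-node : ℕ
  D-node = proj₂ (ΠYNode (suc B) (yNodes B))

  private
    shared-ok = ΠYNode-ok (suc B) (yNodes B) ℕP.≤-refl yNodes-consts

  shared-D : Holds shared D-node D
  shared-D = result (proj₁ shared-ok)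

  shared-D-xFree : XFree shared D-node
  shared-D-xFree = proj₂ shared-ok

  shared-consts : Consts shared
  shared-consts = Consts-mono (prefix (extension (proj₁ shared-ok))) yNodes-consts

  top-shared : top shared ≤ 3 + B + suc B
  top-shared = subst (λ t → top shared ≤ t + suc B) (top-yNodes B) (growth (extension (proj₁ shared-ok)))

-- Fractions and the certificate

module _ {n : ℕ} where
  open CommutativeRing (polyRing {n}) using (semiring) renaming (_+_ to _+ₚ_; _*_ to _*ₚ_)
  open import Algebra.Properties.Semiring.Sum semiring using (sum; sum-syntax)
  open Builder n
  open import Relation.Binary.Reasoning.Setoid (CommutativeRing.setoid (polyRing {n}))
  open PolySolver n using (solve; _:+_; _:*_; _:=_; con)

  record _≐_/_ (r : RF n) (s d : Poly n) : Set where
    constructor ≐-by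
    field
      factor : Poly n
      num≋   : proj₁ r ≋ s *ₚ factor
      den≋   : proj₂ r ≋ d *ₚ factor

  ≐-cong : ∀ {r s s′ d} → s ≋ s′ → r ≐ s / d → r ≐ s′ / d
  ≐-cong {s′ = s′} s≋s′ (≐-by w num den) = ≐-by w (≋-trans num (pmul-congʳ w s≋s′)) den

  rfMul-rfPoly : ∀ {r s d} F → r ≐ s / d → rfMul (rfPoly F) r ≐ F *ₚ s / d
  rfMul-rfPoly {r} {s} {d} F (≐-by w num den) = ≐-by w
    (≋-trans (pmul-congˡ F num) (≋-sym (pmul-assoc F s w)))
    (≋-trans (pmul-identityˡ (proj₂ r)) den)

  rfAdd-≐ : ∀ {r r′ s s′ d} → r ≐ s / d → r′ ≐ s′ / d → rfAdd r r′ ≐ s +ₚ s′ / d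
  rfAdd-≐ {a , b} {a′ , b′} {s} {s′} {d} (≐-by w num den) (≐-by w′ num′ den′) = ≐-by (d *ₚ w *ₚ w′)
    (begin
      a *ₚ b′ +ₚ a′ *ₚ b                         ≈⟨ padd-cong (pmul-cong num den′) (pmul-cong num′ den) ⟩
      s *ₚ w *ₚ (d *ₚ w′) +ₚ s′ *ₚ w′ *ₚ (d *ₚ w)
        ≈⟨ solve 5 (λ s s′ d w w′ → s :* w :* (d :* w′) :+ s′ :* w′ :* (d :* w) := (s :+ s′) :* (d :* w :* w′))
                   ≋-refl s s′ d w w′ ⟩
      (s +ₚ s′) *ₚ (d *ₚ w *ₚ w′)                ∎)
    (begin
      b *ₚ b′                                    ≈⟨ pmul-cong den den′ ⟩
      d *ₚ w *ₚ (d *ₚ w′)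
        ≈⟨ solve 3 (λ d w w′ → d :* w :* (d :* w′) := d :* (d :* w :* w′)) ≋-refl d w w′ ⟩
      d *ₚ (d *ₚ w *ₚ w′)                        ∎)

  rfAdd-zero : ∀ {r s d} → r ≐ s / d → rfAdd r (rfPoly (pconst 0ℚ)) ≐ s / d
  rfAdd-zero {a , b} {s} {d} (≐-by w num den) = ≐-by w
    (≋-trans (solve 2 (λ a b → a :* con 1ℚ :+ con 0ℚ :* b := a) ≋-refl a b) num)
    (≋-trans (pmul-identityʳ b) den)

  divide : (R : Prog) (u v : ℕ) → XFree R v → ¬ (proj₁ (at R v) ≈P []) → Circuit n
  divide R u v (_ , x-free) nonzero = circuit (suc (top R)) (slp R ▷ div (ref (top R) u) (ref (top R) v)) (wf R , x-free , nonzero)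

  divide-≐ : ∀ R {u v s d} x-free nonzero → Holds R u s → Holds R v d → output (divide R u v x-free nonzero) ≐ s / d
  divide-≐ R {d = d} _ _ (holds _ nᵤ dᵤ) (holds _ nᵥ dᵥ) =
    ≐-by 1P (pmul-cong nᵤ dᵥ) (≋-trans (pmul-cong dᵤ nᵥ) (pmul-comm 1P d))

  -- Σ_i F_i h_i in the form in which IsIPSLINCert states it
  sumProducts : ∀ {I : Set} → (I → Poly n) → (I → RF n) → List I → RF n
  sumProducts F h = foldr (λ i acc → rfAdd (rfMul (rfPoly (F i)) (h i)) acc) (rfPoly (pconst 0ℚ))

  sumProducts-≐ : ∀ {I : Set} {d} (F : I → Poly n) (h : I → RF n) (c : I → Poly n) → (∀ i → h i ≐ c i / d) →
    ∀ {m} (f : Fin (suc m) → I) → sumProducts F h (tabulate f) ≐ ∑[ j < suc m ] (F (f j) *ₚ c (f j)) / d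
  sumProducts-≐ F h c h≐c {zero} f =
    ≐-cong (≋-sym (padd-identityʳ _)) (rfAdd-zero (rfMul-rfPoly (F (f zero)) (h≐c (f zero))))
  sumProducts-≐ F h c h≐c {suc m} f =
    rfAdd-≐ (rfMul-rfPoly (F (f zero)) (h≐c (f zero))) (sumProducts-≐ F h c h≐c (f ∘ suc))

circuitSize-bound : ∀ B → 2 + (3 + B + suc B + (1 + (suc B * suc B + B * (3 + suc B * 3)))) ≤ 8 * suc B ^ 2
circuitSize-bound B = subst (λ m → 2 + (3 + B + suc B + (1 + (suc B * suc B + B * (3 + suc B * 3)))) ≤ m) (equation B)
                        (ℕP.m≤m+n _ (6 * B + 4 * (B * B)))
  where
  open ℕ-Solver
  equation : ∀ B → 2 + (3 + B + suc B + (1 + (suc B * suc B + B * (3 + suc B * 3)))) + (6 * B + 4 * (B * B)) ≡ 8 * suc B ^ 2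
  equation = solve 1 (λ B → con 2 :+ (con 3 :+ B :+ (con 1 :+ B) :+ (con 1 :+ ((con 1 :+ B) :* (con 1 :+ B) :+ B :* (con 3 :+ (con 1 :+ B) :* con 3))))
                            :+ (con 6 :* B :+ con 4 :* (B :* B)) := con 8 :* (con 1 :+ B) :^ 2) refl

module Certificate {n : ℕ} (a : Vec ℕ n) where
  open CommutativeRing (polyRing {n}) using (semiring) renaming (_+_ to _+ₚ_; _*_ to _*ₚ_)
  open import Algebra.Properties.Semiring.Sum semiring using (sum; sum-syntax; sum-cong-≋; *-distribˡ-sum)
  open import Algebra.Properties.Semiring.Mult semiring using () renaming (_×_ to _×ₚ_)
  open import Relation.Binary.Reasoning.Setoid (CommutativeRing.setoid (polyRing {n}))
  open PolySolver n using (solve; _:+_; _:*_; _:=_; con)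
  open Builder n

  B : ℕ
  B = sumV a

  open Grid {n} B
  open Circuits {n} B

  numerator : Fin (suc n) → Poly n
  numerator zero    = cofactor a pX 0
  numerator (suc i) = −1ₚ *ₚ correction a pX i 0

  numeratorNode : Fin (suc n) → Prog × ℕ
  numeratorNode zero    = let (R , t) = cofactorTable a id shared in R , t 0
  numeratorNode (suc i) = let (R , t) = correctionTable a id i shared in emit R (mul 1 (t 0)) , suc (top R)

  numeratorNode-ok : ∀ i → BuildsNode shared (1 + gridCost B) (numerator i) (numeratorNode i)
  numeratorNode-ok zero =
    let buildsTable ext tbl = cofactorTable-ok a id shared shared-consts
    in buildsNode (⊑⟨⟩-weaken (ℕP.n≤1+n _) ext) (tbl 0 z≤n)
  numeratorNode-ok (suc i) =
    let buildsTable ext tbl = correctionTable-ok a id i shared shared-consts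
        R = proj₁ (correctionTable a id i shared)
        t = proj₂ (correctionTable a id i shared)
    in buildsNode (⊑⟨⟩-emit ext (mul 1 (t 0)))
                  (emit-mul R (minusOne (Consts-mono (prefix ext) shared-consts)) (tbl 0 z≤n))

  private
    module Ingredients (i : Fin (suc n)) where
      R = proj₁ (numeratorNode i)
      u = proj₂ (numeratorNode i)
      shared⊑R = prefix (extension (numeratorNode-ok i))
      D-holds : Holds R D-node D
      D-holds = keeps shared⊑R shared-D
      D-xFree : XFree R D-node
      D-xFree = keepsXFree shared⊑R shared-D-xFree

  certificate : Fin (suc n) → Circuit n
  certificate i = divide R u D-node D-xFree (ΠY-≉0 (suc B) (num≋ D-holds))
    where open Ingredients i

  certificate-≐ : ∀ i → output (certificate i) ≐ numerator i / D
  certificate-≐ i = divide-≐ R D-xFree (ΠY-≉0 (suc B) (num≋ D-holds)) (result (numeratorNode-ok i)) D-holds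
    where open Ingredients i

  certificate-size : ∀ i → size (certificate i) ≤ 8 * suc B ^ 2
  certificate-size i = ℕP.≤-trans (s≤s (s≤s (growth (extension (numeratorNode-ok i)))))
                         (ℕP.≤-trans (ℕP.+-monoʳ-≤ 2 (ℕP.+-monoˡ-≤ (1 + gridCost B) top-shared)) (circuitSize-bound B))

  sysF-zero : sysF a zero ≋ y+ 0 +ₚ linForm a pX
  sysF-zero = ≋-trans (padd-congˡ pY (terms id)) (≋-sym (padd-assoc pY [] (linForm a pX)))
    where
    terms : ∀ {m} (f : Fin m → Fin n) →
      concatMap (λ i → (ℕtoℚ (lookupV a i) , unitMono (suc i)) ∷ []) (tabulate f)
        ≋ ∑[ i < m ] (lookupV a (f i) ×ₚ 1P *ₚ pX (f i))
    terms {zero}  f = ≋-refl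
    terms {suc m} f = padd-cong (≋-sym (≋-trans (pmul-congʳ (pX (f zero)) (×1≋pconst (lookupV a (f zero))))
                                                (pconst-*-monomial _ (unitMono (suc (f zero))))))
                                (terms (f ∘ suc))

  numerators-sum : ∑[ i < suc n ] (sysF a i *ₚ numerator i) ≋ D
  numerators-sum = begin
    sysF a zero *ₚ cofactor a pX 0 +ₚ ∑[ i < n ] (boolAxiom (pX i) *ₚ (−1ₚ *ₚ correction a pX i 0))
      ≈⟨ padd-cong (pmul-congʳ (cofactor a pX 0) sysF-zero) (∑-scale (λ i → boolAxiom (pX i)) (λ i → correction a pX i 0)) ⟩
    (y+ 0 +ₚ linForm a pX) *ₚ cofactor a pX 0 +ₚ −1ₚ *ₚ Rs
      ≈⟨ padd-congʳ (−1ₚ *ₚ Rs) (certificate-identity a pX 0 ℕP.≤-refl) ⟩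
    D +ₚ Rs +ₚ −1ₚ *ₚ Rs
      ≈⟨ solve 2 (λ D R → D :+ R :+ con (-ℚ 1ℚ) :* R := D) ≋-refl D Rs ⟩
    D ∎
    where
    Rs = ∑[ i < n ] (boolAxiom (pX i) *ₚ correction a pX i 0)
    ∑-scale : ∀ (b c : Fin n → Poly n) → ∑[ i < n ] (b i *ₚ (−1ₚ *ₚ c i)) ≋ −1ₚ *ₚ ∑[ i < n ] (b i *ₚ c i)
    ∑-scale b c = ≋-trans
      (sum-cong-≋ (λ i → solve 2 (λ b c → b :* (con (-ℚ 1ℚ) :* c) := con (-ℚ 1ℚ) :* (b :* c)) ≋-refl (b i) (c i)))
      (≋-sym (*-distribˡ-sum −1ₚ (λ i → b i *ₚ c i)))

  isCertificate : IsIPSLINCert a (output ∘ certificate)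
  isCertificate =
    let ≐-by w num den = sumProducts-≐ (sysF a) (output ∘ certificate) numerator certificate-≐ id
    in ≋⇒≈P (≋-trans num (≋-trans (pmul-congʳ w numerators-sum) (≋-sym den)))

proposition3p9 :
    Σ ℕ λ c → Σ ℕ λ d →
      (n : ℕ) → 1 ≤ n → (a : Vec ℕ n) →
        Σ (Fin (suc n) → Circuit n) λ H →
          IsIPSLINCert a (λ i → output (H i))
          × ((i : Fin (suc n)) → size (H i) ≤ c * suc (sumV a) ^ d)
proposition3p9 = 8 , 2 , λ n _ a → let open Certificate a in certificate , isCertificate , certificate-size
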